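{- Work in intensional Martin-Löf type theory with a cumulative hierarchy of univalent universes $\mathcal{U}_0:\mathcal{U}_1:\dots$. For a natural number $m$ let $\mathcal{U}_m^{\le m} :\equiv \sum_{A:\mathcal{U}_m}\mathsf{is}\text{ - }m\text{ - }\mathsf{type}(A)$, $P_m(X):\equiv\Omega^{m+1}(\mathcal{U}_m^{\le m},X)$ for $X:\mathcal{U}_m^{\le m}$, $\mathsf{Loop}_m :\equiv \sum_{X:\mathcal{U}_m^{\le m}} \pi_1(P_m(X))$ (a type in $\mathcal{U}_{m+1}$), and $\mathsf{Loop}_{ -1}:\equiv\mathbf{2}$. Let $n\ge 0$ and let $h_n$ be a witness that $\mathsf{Loop}_{n-1}$ is an $n$-type. Then the underlying type of the pointed type $\Omega^{n+1}(\mathcal{U}_n, \mathsf{Loop}_{n-1})$ has a non-trivial inhabitant, i.e. an element $b$ together with a proof of $\neg(b_0 = b)$, where $b_0$ is the basepoint. The same holds for $\Omega^{n+1}\big(\mathcal{U}_n^{\le n}, (\mathsf{Loop}_{n-1}, h_n)\big)$.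
   Context: No higher inductive types are assumed. Truncation levels: $\mathsf{is}\text{ - }(-2)\text{ - }\mathsf{type}(B):\equiv\sum_{b:B}\prod_{x:B} b=x$ and $\mathsf{is}\text{ - }(k+1)\text{ - }\mathsf{type}(B):\equiv\prod_{x,y:B}\mathsf{is}\text{ - }k\text{ - }\mathsf{type}(x=y)$. Loop spaces: $\Omega(B,b):\equiv((b=b),\mathsf{refl}_b)$, $\Omega^0(B,b):\equiv(B,b)$, $\Omega^{k+1}(B,b):\equiv\Omega^k(\Omega(B,b))$; $\pi_1$ gives the underlying type of a pointed type. -}

{-# OPTIONS --without-K #-}
module Defs where

open import Level using (Level; _⊔_; 0ℓ) renaming (suc to lsuc)
open import Data.Nat using (ℕ; zero; suc; _+_)
open import Data.Bool using (Bool)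
open import Data.Product using (Σ; _,_; proj₁; proj₂)
open import Relation.Binary.PropositionalEquality using (_≡_; refl)

-- Truncation levels, indexed from -2 by an offset:
-- hasLevel k A  means  is-(k-2)-type(A).
is-contr : ∀ {ℓ} → Set ℓ → Set ℓ
is-contr B = Σ B (λ b → ∀ x → b ≡ x)

hasLevel : ∀ {ℓ} → ℕ → Set ℓ → Set ℓ
hasLevel zero    B = is-contr B
hasLevel (suc k) B = (x y : B) → hasLevel k (x ≡ y)

is-_-type : ∀ {ℓ} → ℕ → Set ℓ → Set ℓ
is- m -type B = hasLevel (suc (suc m)) B

fiber : ∀ {a b} {A : Set a} {B : Set b} → (A → B) → B → Set (a ⊔ b)
fiber {A = A} f y = Σ A (λ x → f x ≡ y)

isEquiv : ∀ {a b} {A : Set a} {B : Set b} → (A → B) → Set (a ⊔ b)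
isEquiv f = ∀ y → is-contr (fiber f y)

_≃_ : ∀ {a b} → Set a → Set b → Set (a ⊔ b)
A ≃ B = Σ (A → B) isEquiv

idEquiv : ∀ {ℓ} (A : Set ℓ) → A ≃ A
idEquiv A = (λ x → x) , λ y → (y , refl) , λ { (x , refl) → refl }

idtoeqv : ∀ {ℓ} {A B : Set ℓ} → A ≡ B → A ≃ B
idtoeqv {A = A} refl = idEquiv A

Univalence : (ℓ : Level) → Set (lsuc ℓ)
Univalence ℓ = (A B : Set ℓ) → isEquiv (idtoeqv {ℓ} {A} {B})

Pointed : (ℓ : Level) → Set (lsuc ℓ)
Pointed ℓ = Σ (Set ℓ) (λ A → A)

π₁ : ∀ {ℓ} → Pointed ℓ → Set ℓ
π₁ = proj₁

pt : ∀ {ℓ} (X : Pointed ℓ) → π₁ X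
pt = proj₂

Ω : ∀ {ℓ} → Pointed ℓ → Pointed ℓ
Ω (B , b) = (b ≡ b) , refl

Ω^ : ∀ {ℓ} → ℕ → Pointed ℓ → Pointed ℓ
Ω^ zero    X = X
Ω^ (suc k) X = Ω^ k (Ω X)

lvl : ℕ → Level
lvl zero    = 0ℓ
lvl (suc m) = lsuc (lvl m)

U : (m : ℕ) → Set (lvl (suc m))
U m = Set (lvl m)

U≤ : (m : ℕ) → Set (lvl (suc m))
U≤ m = Σ (U m) (λ A → is- m -type A)

P : (m : ℕ) → U≤ m → Pointed (lvl (suc m))
P m X = Ω^ (suc m) (U≤ m , X)

-- LoopShift n  is  Loop_{n-1}  (a type in U_n):
-- Loop_{-1} = 2,  Loop_m = Σ_{X : U_m^{≤m}} π₁(P_m(X)).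
LoopShift : (n : ℕ) → U n
LoopShift zero    = Bool
LoopShift (suc m) = Σ (U≤ m) (λ X → π₁ (P m X))

{-# OPTIONS --without-K #-}

-- Univalence, together with the function extensionality it implies, identifies
-- Ω^(n+1)(U_n, A) with Ω^n(A ≃ A, id); as being an equivalence is a proposition,
-- this is Ω^n(A → A, id) ≃ Π (x : A), Ω^n(A, x) for A = Loop_(n-1).  For n = 0,
-- negation is a non-trivial point of A ≃ A.  For n = m + 1, every x = (X, p) of
-- Loop_m carries the loop p in Ω^(m+1)(U_m^≤m, X), which lifts to a loop at x in
-- Loop_m; this section is non-trivial at the point whose second component is the
-- non-trivial loop obtained for n = m.  Finally, since being an n-type is a
-- proposition, Ω^(n+1) of U_n^≤n agrees with that of U_n.
module Submission where

open import Defs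
open import Level using (Level)
open import Data.Nat using (ℕ; zero; suc; _+_)
open import Data.Bool using (Bool; true; false; not)
open import Data.Bool.Properties using (_≟_; not-involutive)
open import Data.Product using (Σ; _×_; _,_; proj₁; proj₂)
open import Data.Product.Properties using (Σ-≡,≡→≡; Σ-≡,≡↔≡)
open import Function using (_∘_)
open import Function.Bundles using (_↔_; Inverse; mk↔ₛ′)
open import Function.Properties.Inverse using (↔-refl; ↔-sym; ↔-trans)
open import Relation.Binary.PropositionalEquality
open import Relation.Nullary using (¬_)
open import Axiom.UniquenessOfIdentityProofs using (module Decidable⇒UIP)

open Inverse using (to; from; strictlyInverseˡ; strictlyInverseʳ)
open ≡-Reasoning

private
  variable
    a b : Level
    A : Set a
    B : Set b
    x y : A

conj : {x x′ y y′ : A} → x′ ≡ x → x′ ≡ y′ → y′ ≡ y → x ≡ y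
conj α q β = trans (trans (sym α) q) β

trans-conj : {u v w z : A} (α : u ≡ v) (q : u ≡ w) (β : w ≡ z) → trans α (conj α q β) ≡ trans q β
trans-conj refl q β = refl

cong-retraction : (s : A → B) (r : B → A) (rs : ∀ x → r (s x) ≡ x) (p : x ≡ y) →
                  conj (rs x) (cong r (cong s p)) (rs y) ≡ p
cong-retraction {x = x} s r rs refl =
  trans (cong (λ q → trans q (rs x)) (trans-reflʳ (sym (rs x)))) (trans-symˡ (rs x))

homotopy-natural : (f : A → B) (g : B → A) (η : ∀ x → g (f x) ≡ x) (p : x ≡ y) →
                   trans (η x) p ≡ trans (cong g (cong f p)) (η y)
homotopy-natural {x = x} f g η refl = trans-reflʳ (η x)

cong-↔ : (I : A ↔ B) → (x ≡ y) ↔ (to I x ≡ to I y)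
cong-↔ {A = A} {B = B} {x = x} {y = y} I =
  mk↔ₛ′ (cong f) (λ q → conj (η x) (cong g q) (η y)) section (cong-retraction f g η)
  where
  f : A → B
  f = to I
  g : B → A
  g = from I
  η : ∀ x → g (f x) ≡ x
  η = strictlyInverseʳ I
  ε : ∀ y → f (g y) ≡ y
  ε = strictlyInverseˡ I

  -- cong g has a retraction, so it suffices to compare images under cong g.
  section : (q : f x ≡ f y) → cong f (conj (η x) (cong g q) (η y)) ≡ q
  section q = begin
    cong f p′                                     ≡⟨ cong-retraction g f ε (cong f p′) ⟨
    conj (ε _) (cong f (cong g (cong f p′))) (ε _) ≡⟨ cong (λ t → conj (ε _) (cong f t) (ε _)) g-image ⟩
    conj (ε _) (cong f (cong g q)) (ε _)           ≡⟨ cong-retraction g f ε q ⟩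
    q                                             ∎
    where
    p′ : x ≡ y
    p′ = conj (η x) (cong g q) (η y)
    g-image : cong g (cong f p′) ≡ cong g q
    g-image = trans-injectiveˡ (η y)
      (trans (sym (homotopy-natural f g η p′)) (trans-conj (η x) (cong g q) (η y)))

module _ {A : Set a} {P : A → Set b} where

  Σ-≡↔ : {u v : Σ A P} → (u ≡ v) ↔ Σ (proj₁ u ≡ proj₁ v) (λ q → subst P q (proj₂ u) ≡ proj₂ v)
  Σ-≡↔ = ↔-sym Σ-≡,≡↔≡

  cong-proj₁-Σ-≡,≡→≡ : {u : P x} {v : P y} (q : x ≡ y) (r : subst P q u ≡ v) →
                       cong proj₁ (Σ-≡,≡→≡ {p₁ = x , u} {p₂ = y , v} (q , r)) ≡ q
  cong-proj₁-Σ-≡,≡→≡ refl refl = refl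

  cong-proj₁-↔ : (∀ x → hasLevel 1 (P x)) → {u v : Σ A P} → (u ≡ v) ↔ (proj₁ u ≡ proj₁ v)
  cong-proj₁-↔ hP {u} {v} = mk↔ₛ′ (cong proj₁) lift (λ q → cong-proj₁-Σ-≡,≡→≡ q _) lift-cong-proj₁
    where
    lift : ∀ {v} → proj₁ u ≡ proj₁ v → u ≡ v
    lift {v} q = Σ-≡,≡→≡ (q , proj₁ (hP _ (subst P q (proj₂ u)) (proj₂ v)))

    lift-cong-proj₁ : ∀ {v} (t : u ≡ v) → lift (cong proj₁ t) ≡ t
    lift-cong-proj₁ refl = cong (λ r → Σ-≡,≡→≡ (refl , r)) (proj₂ (hP _ (proj₂ u) (proj₂ u)) refl)

singleton-is-contr : (x : A) → is-contr (Σ A (x ≡_))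
singleton-is-contr x = (x , refl) , λ { (_ , refl) → refl }

is-contr⇒≡ : is-contr A → (x y : A) → x ≡ y
is-contr⇒≡ (_ , h) x y = trans (sym (h x)) (h y)

all-≡⇒hasLevel1 : ((x y : A) → x ≡ y) → hasLevel 1 A
all-≡⇒hasLevel1 p x y = trans (sym (p x x)) (p x y) , canonical
  where
  canonical : ∀ {y} (q : x ≡ y) → trans (sym (p x x)) (p x y) ≡ q
  canonical refl = trans-symˡ (p x x)

hasLevel-suc : ∀ k → hasLevel k A → hasLevel (suc k) A
hasLevel-suc zero    c     = all-≡⇒hasLevel1 (is-contr⇒≡ c)
hasLevel-suc (suc k) h x y = hasLevel-suc k (h x y)

is-contr⇒hasLevel : ∀ k → is-contr A → hasLevel k A
is-contr⇒hasLevel zero    c     = c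
is-contr⇒hasLevel (suc k) c x y = is-contr⇒hasLevel k (hasLevel-suc zero c x y)

hasLevel-raise : ∀ k j → hasLevel k A → hasLevel (k + j) A
hasLevel-raise zero    j c     = is-contr⇒hasLevel j c
hasLevel-raise (suc k) j h x y = hasLevel-raise k j (h x y)

hasLevel-retract : ∀ k (s : A → B) (r : B → A) → (∀ x → r (s x) ≡ x) → hasLevel k B → hasLevel k A
hasLevel-retract zero    s r rs (c , h) = r c , λ x → trans (cong r (h (s x))) (rs x)
hasLevel-retract (suc k) s r rs h x y   =
  hasLevel-retract k (cong s) (λ q → conj (rs x) (cong r q) (rs y)) (cong-retraction s r rs) (h (s x) (s y))

hasLevel-↔ : ∀ k → A ↔ B → hasLevel k B → hasLevel k A
hasLevel-↔ k I = hasLevel-retract k (to I) (from I) (strictlyInverseʳ I)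

Σ-hasLevel : ∀ k {P : A → Set b} → hasLevel k A → (∀ x → hasLevel k (P x)) → hasLevel k (Σ A P)
Σ-hasLevel zero (c , h) hP =
  (c , proj₁ (hP c)) , λ (x , u) → Σ-≡,≡→≡ (h x , is-contr⇒≡ (hP x) _ u)
Σ-hasLevel (suc k) {P} hA hP (x , u) (y , v) =
  hasLevel-↔ k Σ-≡↔ (Σ-hasLevel k (hA x y) (λ q → hP y (subst P q u) v))

Ω^-hasLevel2 : ∀ j {x : A} → hasLevel (2 + j) A → hasLevel 2 (π₁ (Ω^ j (A , x)))
Ω^-hasLevel2 zero        h = h
Ω^-hasLevel2 (suc j) {x} h = Ω^-hasLevel2 j (h x x)

Bool-hasLevel2 : hasLevel 2 Bool
Bool-hasLevel2 x y = all-≡⇒hasLevel1 (Decidable⇒UIP.≡-irrelevant _≟_)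

Ω^-↔ : ∀ k (I : A ↔ B) {x : A} → π₁ (Ω^ k (A , x)) ↔ π₁ (Ω^ k (B , to I x))
Ω^-↔ zero    I = I
Ω^-↔ (suc k) I = Ω^-↔ k (cong-↔ I)

Ω^-↔-pt : ∀ k (I : A ↔ B) {x : A} → to (Ω^-↔ k I {x}) (pt (Ω^ k (A , x))) ≡ pt (Ω^ k (B , to I x))
Ω^-↔-pt zero    I = refl
Ω^-↔-pt (suc k) I = Ω^-↔-pt k (cong-↔ I)

Nontrivial : Pointed a → Set a
Nontrivial X = Σ (π₁ X) (λ b → ¬ (pt X ≡ b))

from-≢ : (I : A ↔ B) → to I x ≡ y → ∀ {c} → ¬ (y ≡ c) → ¬ (x ≡ from I c)
from-≢ I fx≡y y≢c x≡gc = y≢c (trans (sym fx≡y) (trans (cong (to I) x≡gc) (strictlyInverseˡ I _)))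

Nontrivial-↔ : (I : A ↔ B) → to I x ≡ y → Nontrivial (B , y) → Nontrivial (A , x)
Nontrivial-↔ I fx≡y (c , y≢c) = from I c , from-≢ I fx≡y y≢c

Ω^-Nontrivial-↔ : ∀ k (I : A ↔ B) → Nontrivial (Ω^ k (B , to I x)) → Nontrivial (Ω^ k (A , x))
Ω^-Nontrivial-↔ k I = Nontrivial-↔ (Ω^-↔ k I) (Ω^-↔-pt k I)

Ω^-Nontrivial-Σ-prop : ∀ k {P : A → Set b} → (∀ x → hasLevel 1 (P x)) → {u : P x} →
                       Nontrivial (Ω^ (suc k) (A , x)) → Nontrivial (Ω^ (suc k) (Σ A P , (x , u)))
Ω^-Nontrivial-Σ-prop k hP = Ω^-Nontrivial-↔ k (cong-proj₁-↔ hP)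

isEquiv⇒↔ : {f : A → B} → isEquiv f → A ↔ B
isEquiv⇒↔ {f = f} e =
  mk↔ₛ′ f (λ y → proj₁ (proj₁ (e y))) (λ y → proj₂ (proj₁ (e y)))
        (λ x → cong proj₁ (proj₂ (e (f x)) (x , refl)))

proj₁-isEquiv : {P : A → Set b} → (∀ x → is-contr (P x)) → isEquiv (proj₁ {B = P})
proj₁-isEquiv hc x =
  ((x , proj₁ (hc x)) , refl) , λ { ((x , u) , refl) → cong (λ v → (x , v) , refl) (proj₂ (hc x) u) }

not-isEquiv : isEquiv not
not-isEquiv y = (not y , not-involutive y) , λ { (true , refl) → refl ; (false , refl) → refl }

subst-loop : (q : x ≡ y) (p : x ≡ x) → subst (λ z → z ≡ z) q p ≡ conj q p q
subst-loop refl p = sym (trans-reflʳ p)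

subst-loop-self : (p : x ≡ x) → subst (λ z → z ≡ z) p p ≡ p
subst-loop-self p = trans (subst-loop p p) (cong (λ r → trans r p) (trans-symˡ p))

module _ {ℓ : Level} (ua : Univalence ℓ) where

  idtoeqv-↔ : {X Y : Set ℓ} → (X ≡ Y) ↔ (X ≃ Y)
  idtoeqv-↔ {X} {Y} = isEquiv⇒↔ (ua X Y)

  postcomp-isEquiv : {X Y : Set ℓ} (T : Set ℓ) (e : X ≃ Y) → isEquiv (λ (h : T → X) → proj₁ e ∘ h)
  postcomp-isEquiv {X} T e =
    subst (λ e → isEquiv (λ h → proj₁ e ∘ h)) (strictlyInverseˡ idtoeqv-↔ e)
          (idtoeqv-postcomp (from idtoeqv-↔ e))
    where
    idtoeqv-postcomp : ∀ {Y} (p : X ≡ Y) → isEquiv (λ (h : T → X) → proj₁ (idtoeqv p) ∘ h)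
    idtoeqv-postcomp refl = proj₂ (idEquiv (T → X))

  -- Π P is a retract of the fibre over id of postcomposition with the equivalence proj₁ : Σ A P → A.
  Π-is-contr : {A : Set ℓ} {P : A → Set ℓ} → (∀ x → is-contr (P x)) → is-contr ((x : A) → P x)
  Π-is-contr {A} {P} hc =
    hasLevel-retract 0 (λ f → (λ x → x , f x) , refl) retraction (λ _ → refl)
      (postcomp-isEquiv A (proj₁ , proj₁-isEquiv hc) (λ x → x))
    where
    retraction : fiber (λ (h : A → Σ A P) → proj₁ ∘ h) (λ x → x) → (x : A) → P x
    retraction (h , p) x = subst P (cong-app p x) (proj₂ (h x))

  cong-app-↔ : {A : Set ℓ} {P : A → Set ℓ} {f g : (x : A) → P x} → (f ≡ g) ↔ (∀ x → f x ≡ g x)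
  cong-app-↔ {A} {P} {f} =
    mk↔ₛ′ cong-app funext (λ k → cong-app-funext (_ , k) (center≡ _)) funext-cong-app
    where
    Homotopies : Set ℓ
    Homotopies = Σ ((x : A) → P x) (λ g → ∀ x → f x ≡ g x)

    Homotopies-is-contr : is-contr Homotopies
    Homotopies-is-contr =
      hasLevel-retract 0 (λ (g , k) x → g x , k x) (λ v → (λ x → proj₁ (v x)) , (λ x → proj₂ (v x)))
        (λ _ → refl)
        (Π-is-contr (λ x → singleton-is-contr (f x)))

    center≡ : (w : Homotopies) → (f , λ _ → refl) ≡ w
    center≡ = is-contr⇒≡ Homotopies-is-contr _

    funext : ∀ {g} → (∀ x → f x ≡ g x) → f ≡ g
    funext k = cong proj₁ (center≡ (_ , k))

    funext-cong-app : ∀ {g} (p : f ≡ g) → funext (cong-app p) ≡ p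
    funext-cong-app refl = cong (cong proj₁) (trans-symˡ (proj₂ Homotopies-is-contr _))

    cong-app-funext : (w : Homotopies) (t : (f , λ _ → refl) ≡ w) → cong-app (cong proj₁ t) ≡ proj₂ w
    cong-app-funext _ refl = refl

  Π-hasLevel : ∀ k {A : Set ℓ} {P : A → Set ℓ} → (∀ x → hasLevel k (P x)) → hasLevel k ((x : A) → P x)
  Π-hasLevel zero    h     = Π-is-contr h
  Π-hasLevel (suc k) h f g = hasLevel-↔ k cong-app-↔ (Π-hasLevel k (λ x → h x (f x) (g x)))

  is-contr-hasLevel1 : {X : Set ℓ} → hasLevel 1 (is-contr X)
  is-contr-hasLevel1 {X} c = Σ-hasLevel 1 X-prop (λ x → Π-hasLevel 1 (λ y → hasLevel-suc 1 X-prop x y)) c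
    where
    X-prop : hasLevel 1 X
    X-prop = hasLevel-suc 0 c

  hasLevel-hasLevel1 : ∀ k {X : Set ℓ} → hasLevel 1 (hasLevel k X)
  hasLevel-hasLevel1 zero    = is-contr-hasLevel1
  hasLevel-hasLevel1 (suc k) = Π-hasLevel 1 (λ _ → Π-hasLevel 1 (λ _ → hasLevel-hasLevel1 k))

  isEquiv-hasLevel1 : {X Y : Set ℓ} (f : X → Y) → hasLevel 1 (isEquiv f)
  isEquiv-hasLevel1 f = Π-hasLevel 1 (λ _ → is-contr-hasLevel1)

  TypeOfLevel-hasLevel : ∀ k → hasLevel (suc (suc k)) (Σ (Set ℓ) (hasLevel (suc k)))
  TypeOfLevel-hasLevel k (X , _) (Y , hY) =
    hasLevel-↔ (suc k) (cong-proj₁-↔ (λ _ → hasLevel-hasLevel1 (suc k)))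
      (hasLevel-↔ (suc k) idtoeqv-↔
        (Σ-hasLevel (suc k) (Π-hasLevel (suc k) (λ _ → hY)) (λ f → hasLevel-raise 1 k (isEquiv-hasLevel1 f))))

  Ω^-Π-↔ : ∀ k {A : Set ℓ} {P : A → Set ℓ} (f : (x : A) → P x) →
           π₁ (Ω^ k (((x : A) → P x) , f)) ↔ ((x : A) → π₁ (Ω^ k (P x , f x)))
  Ω^-Π-↔ zero    f = ↔-refl
  Ω^-Π-↔ (suc k) f = ↔-trans (Ω^-↔ k cong-app-↔) (Ω^-Π-↔ k (λ x → refl {x = f x}))

  Ω^-Π-↔-pt : ∀ k {A : Set ℓ} {P : A → Set ℓ} (f : (x : A) → P x) →
              to (Ω^-Π-↔ k f) (pt (Ω^ k (((x : A) → P x) , f))) ≡ (λ x → pt (Ω^ k (P x , f x)))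
  Ω^-Π-↔-pt zero    f = refl
  Ω^-Π-↔-pt (suc k) f =
    trans (cong (to (Ω^-Π-↔ k (λ x → refl {x = f x}))) (Ω^-↔-pt k cong-app-↔)) (Ω^-Π-↔-pt k (λ x → refl))

module _ (ua : ∀ ℓ → Univalence ℓ) where

  U≤-hasLevel : ∀ m → hasLevel (3 + m) (U≤ m)
  U≤-hasLevel m = TypeOfLevel-hasLevel (ua (lvl m)) (suc m)

  Loop-is-type : ∀ n → is- n -type (LoopShift n)
  Loop-is-type zero    = Bool-hasLevel2
  Loop-is-type (suc m) =
    Σ-hasLevel (3 + m) (U≤-hasLevel m) (λ _ → hasLevel-raise 2 (suc m) (Ω^-hasLevel2 (suc m) (U≤-hasLevel m)))

  -- For m ≥ 1 the second component of a loop at (X , p) is a path between higher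
  -- loops, which form a set; so such loops are determined by their first component.
  lift-loop-↔ : ∀ m X (p : π₁ (P (suc m) X)) →
                π₁ (Ω^ (2 + m) (LoopShift (2 + m) , (X , p))) ↔ π₁ (P (suc m) X)
  lift-loop-↔ m X p =
    ↔-trans (Ω^-↔ (suc m) Σ-≡↔)
            (Ω^-↔ m (cong-proj₁-↔ λ q →
               Ω^-hasLevel2 (2 + m) (U≤-hasLevel (suc m)) (subst (π₁ ∘ P (suc m)) q p) p))

  lift-loop-↔-pt : ∀ m X (p : π₁ (P (suc m) X)) →
                   to (lift-loop-↔ m X p) (pt (Ω^ (2 + m) (LoopShift (2 + m) , (X , p)))) ≡ pt (P (suc m) X)
  lift-loop-↔-pt m X p = trans (cong (to (Ω^-↔ m (cong-proj₁-↔ _))) (Ω^-↔-pt (suc m) Σ-≡↔)) (Ω^-↔-pt m _)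

  lift-loop : ∀ m (w : LoopShift (suc m)) → π₁ (Ω^ (suc m) (LoopShift (suc m) , w))
  lift-loop zero    (X , p) = Σ-≡,≡→≡ (p , subst-loop-self p)
  lift-loop (suc m) (X , p) = from (lift-loop-↔ m X p) p

  lift-loop-nontrivial : ∀ m (w : LoopShift (suc m)) → ¬ (pt (P m (proj₁ w)) ≡ proj₂ w) →
                         ¬ (pt (Ω^ (suc m) (LoopShift (suc m) , w)) ≡ lift-loop m w)
  lift-loop-nontrivial zero    (X , p) p≢refl e = p≢refl (trans (cong (cong proj₁) e) (cong-proj₁-Σ-≡,≡→≡ p _))
  lift-loop-nontrivial (suc m) (X , p) p≢refl   = from-≢ (lift-loop-↔ m X p) (lift-loop-↔-pt m X p) p≢refl

  Ω^-U-Loop-Nontrivial : ∀ n → Nontrivial (Ω^ (suc n) (U n , LoopShift n))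
  Ω^-U-Loop-Nontrivial zero =
    Ω^-Nontrivial-↔ 0 (idtoeqv-↔ (ua _))
      ((not , not-isEquiv) , λ e → true≢false (cong (λ e → proj₁ e true) e))
    where
    true≢false : ¬ (true ≡ false)
    true≢false ()
  Ω^-U-Loop-Nontrivial (suc m) =
    Ω^-Nontrivial-↔ (suc m) (idtoeqv-↔ (ua _))
      (Ω^-Nontrivial-Σ-prop m (isEquiv-hasLevel1 (ua _))
        (Nontrivial-↔ (Ω^-Π-↔ (ua _) (suc m) (λ x → x)) (Ω^-Π-↔-pt (ua _) (suc m) (λ x → x))
          (lift-loop m , λ e → lift-loop-nontrivial m x₀ (proj₂ loop₀) (cong-app e x₀))))
    where
    loop₀ : Nontrivial (P m (LoopShift m , Loop-is-type m))
    loop₀ = Ω^-Nontrivial-Σ-prop m (λ _ → hasLevel-hasLevel1 (ua _) (2 + m)) (Ω^-U-Loop-Nontrivial m)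
    x₀ : LoopShift (suc m)
    x₀ = (LoopShift m , Loop-is-type m) , proj₁ loop₀

lemma5p8 : (ua : (ℓ : Level) → Univalence ℓ) → (n : ℕ) → (h : is- n -type (LoopShift n))
    → Σ (π₁ (Ω^ (suc n) (U n , LoopShift n))) (λ b → ¬ (pt (Ω^ (suc n) (U n , LoopShift n)) ≡ b))
    × Σ (π₁ (Ω^ (suc n) (U≤ n , (LoopShift n , h)))) (λ b → ¬ (pt (Ω^ (suc n) (U≤ n , (LoopShift n , h))) ≡ b))
lemma5p8 ua n h =
  Ω^-U-Loop-Nontrivial ua n ,
  Ω^-Nontrivial-Σ-prop n (λ _ → hasLevel-hasLevel1 (ua (lvl n)) (2 + n)) (Ω^-U-Loop-Nontrivial ua n)
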